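{- Let $\mathcal T$ be a family of terminal sets such that $G_{\mathcal T} := G[\bigcup_{T \in \mathcal T} T]$ is connected. If $\mathcal T$ contains at least four sets then it contains a triplet.
   Context: Let $(G;T_1,\dots,T_k)$ be a pairwise $\frac{1}{2}$-dense instance of Steiner Forest without Steiner nodes, i.e. $V(G)=T_1\cup\dots\cup T_k$ with the $T_i$ pairwise disjoint, and each terminal $t\in T_i$ has at least $|T_j|/2$ neighbours in $T_j$ for every $j\neq i$. Three distinct terminal sets $T_i, T_j, T_\ell$ form a triplet if $G[T_i \cup T_j \cup T_\ell]$ is connected. -}

module Defs where

open import Data.Nat using (ℕ; zero; suc; _*_; _≤_)
open import Data.Bool using (Bool; true; false; _∧_)
open import Data.Fin using (Fin)
open import Data.Fin.Properties using (_≟_)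
open import Data.List using (List; length; filterᵇ; allFin)
open import Data.Product using (Σ; ∃; _×_)
open import Data.Sum using (_⊎_)
open import Relation.Nullary using (¬_)
open import Relation.Nullary.Decidable using (⌊_⌋)
open import Relation.Binary.PropositionalEquality using (_≡_)
open import Data.Fin.Subset using (Subset; _∈_)

record SimpleGraph (n : ℕ) : Set where
  field
    adj   : Fin n → Fin n → Bool
    sym   : ∀ u v → adj u v ≡ adj v u
    irrefl : ∀ v → adj v v ≡ false
open SimpleGraph public

count : {n : ℕ} → (Fin n → Bool) → ℕ
count {n} p = length (filterᵇ p (allFin n))

-- An instance of Steiner Forest without Steiner nodes: a graph G on Fin n and
-- a map col : Fin n → Fin k; the terminal set T_i is { v | col v ≡ i }.
-- The sets T_i are thus pairwise disjoint and cover V(G).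
inT : {n k : ℕ} → (Fin n → Fin k) → Fin k → Fin n → Bool
inT col i v = ⌊ col v ≟ i ⌋

size : {n k : ℕ} → (Fin n → Fin k) → Fin k → ℕ
size col i = count (inT col i)

nbrsIn : {n k : ℕ} → SimpleGraph n → (Fin n → Fin k) → Fin n → Fin k → ℕ
nbrsIn G col t j = count (λ v → adj G t v ∧ inT col j v)

HalfDense : {n k : ℕ} → SimpleGraph n → (Fin n → Fin k) → Set
HalfDense G col = ∀ t j → ¬ (col t ≡ j) → size col j ≤ 2 * nbrsIn G col t j

NonemptyTerminals : {n k : ℕ} → (Fin n → Fin k) → Set
NonemptyTerminals {n} col = ∀ i → Σ (Fin n) (λ v → col v ≡ i)

data Walk {n : ℕ} (G : SimpleGraph n) (S : Fin n → Set) : Fin n → Fin n → Set where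
  stop : ∀ {u} → Walk G S u u
  step : ∀ {u w v} → adj G u w ≡ true → S w → Walk G S w v → Walk G S u v

Connected : {n : ℕ} → SimpleGraph n → (Fin n → Set) → Set
Connected G S = ∀ u v → S u → S v → Walk G S u v

UnionOf : {n k : ℕ} → (Fin n → Fin k) → Subset k → Fin n → Set
UnionOf col F v = col v ∈ F

Union3 : {n k : ℕ} → (Fin n → Fin k) → Fin k → Fin k → Fin k → Fin n → Set
Union3 col i j l v = col v ≡ i ⊎ col v ≡ j ⊎ col v ≡ l

Triplet : {n k : ℕ} → SimpleGraph n → (Fin n → Fin k) → Fin k → Fin k → Fin k → Set
Triplet G col i j l =
  ¬ (i ≡ j) × ¬ (i ≡ l) × ¬ (j ≡ l) × Connected G (Union3 col i j l)

ContainsTriplet : {n k : ℕ} → SimpleGraph n → (Fin n → Fin k) → Subset k → Set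
ContainsTriplet {k = k} G col F =
  Σ (Fin k) λ i → Σ (Fin k) λ j → Σ (Fin k) λ l →
    i ∈ F × j ∈ F × l ∈ F × Triplet G col i j l

-- Suppose the family has no triplet. By half-density every vertex outside a
-- terminal set T_i sees at least |T_i|/2 vertices of T_i, so among any three
-- such vertices two have a common neighbour in T_i. Consequently, if
-- T_i, T_j, T_l is not a triplet, two vertices of T_i ∪ T_j joined inside
-- G[T_i ∪ T_j ∪ T_l] are already joined inside G[T_i ∪ T_j]: otherwise the two
-- ends, and a vertex cut off from them in G[T_i ∪ T_j ∪ T_l], step out of T_i
-- to three vertices no two of which may share a neighbour in T_i. Walking
-- through the connected graph G_𝒯 from a vertex x, this keeps x joined to the
-- current vertex inside every G[T_i ∪ T_j] containing both. For any three
-- sets of 𝒯 this makes their union connected, i.e. a triplet; so three sets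
-- already suffice.
module Submission where

open import Defs
open import Data.Nat using (ℕ; _≤_; zero; suc; _+_; _*_; _<_; _≤′_; ≤′-refl; ≤′-step; z≤n; s≤s)
open import Data.Fin using (Fin)
open import Data.Fin.Subset using (Subset; ∣_∣; _∈_; _∉_; ⊥; ⁅_⁆; _∪_; _⊆_)

open import Level using (0ℓ)
open import Data.Nat.Properties
  using (≤-trans; ≤-reflexive; ≤-total; ≤⇒≤′; m≤n⇒m≤1+n; n≤1+n; +-suc; +-mono-≤; +-monoʳ-≤; *-monoʳ-≤;
         +-cancelˡ-≤; <⇒≱; ≰⇒>; <-≤-trans; ≤-<-trans; module ≤-Reasoning)
open import Data.Nat.Tactic.RingSolver using (solve-∀)
open import Data.Bool using (Bool; true; false; T; _∧_; _∨_)
open import Data.Bool.Properties using (T-∧; T-∨; T-≡) renaming (_≟_ to _≟ᵇ_)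
open import Data.Fin.Properties using (_≟_; any?; all?; ¬∀⟶∃¬)
open import Data.Fin.Subset.Properties
  using (_∈?_; p⊆q⇒∣p∣≤∣q∣; ∣⊥∣≡0; ∣⁅x⁆∣≡1; x∈⁅x⁆; x∉⁅y⁆⇒x≢y; x∈p∪q⁺)
open import Data.List using ([]; _∷_; length; filterᵇ; allFin)
open import Data.List.Properties using (length-filter; filter-some; length-tabulate)
open import Data.List.Membership.Propositional using (lose) renaming (_∈_ to _∈ˡ_)
open import Data.List.Membership.Propositional.Properties using (∈-allFin)
open import Data.List.Relation.Unary.Any using (here; there)
open import Data.Product using (∃; _×_; _,_; proj₁; proj₂; map; map₂)
open import Data.Sum using (_⊎_; inj₁; inj₂; [_,_])
import Data.Sum as Sum
open import Data.Vec using ([]; _∷_)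
open import Data.Empty using (⊥-elim)
open import Function using (_∘_; id)
open import Function.Bundles using (Equivalence)
open import Relation.Nullary using (¬_; Dec; yes; no)
open import Relation.Nullary.Decidable
  using (⌊_⌋; T?; toWitness; fromWitness; decidable-stable; _×-dec_; _⊎-dec_; _→-dec_; ¬?)
open import Relation.Unary using (Pred; Decidable; _⊢_) renaming (_⊆_ to _⊆ᵖ_)
open import Relation.Binary.PropositionalEquality
  using (_≡_; _≢_; refl; trans; cong; cong₂; subst) renaming (sym to ≡-sym)

open Equivalence using (to; from)

module _ {a} {A : Set a} where

  length-filterᵇ-mono : {p q : A → Bool} → T ∘ p ⊆ᵖ T ∘ q →
    ∀ xs → length (filterᵇ p xs) ≤ length (filterᵇ q xs)
  length-filterᵇ-mono p⊆q [] = z≤n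
  length-filterᵇ-mono {p} {q} p⊆q (x ∷ xs) with p x | q x | p⊆q {x}
  ... | true  | true  | _ = s≤s (length-filterᵇ-mono p⊆q xs)
  ... | true  | false | p⊆qₓ with () ← p⊆qₓ _
  ... | false | true  | _ = m≤n⇒m≤1+n (length-filterᵇ-mono p⊆q xs)
  ... | false | false | _ = length-filterᵇ-mono p⊆q xs

  length-filterᵇ-< : {p q : A → Bool} → T ∘ p ⊆ᵖ T ∘ q →
    ∀ {x xs} → x ∈ˡ xs → ¬ T (p x) → T (q x) →
    length (filterᵇ p xs) < length (filterᵇ q xs)
  length-filterᵇ-< {p} {q} p⊆q {xs = y ∷ ys} (here refl) ¬py qy with p y | q y
  ... | true  | _    = ⊥-elim (¬py _)
  ... | false | true = s≤s (length-filterᵇ-mono p⊆q ys)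
  length-filterᵇ-< {p} {q} p⊆q {xs = y ∷ ys} (there x∈ys) ¬px qx with p y | q y | p⊆q {y}
  ... | true  | true  | _ = s≤s (length-filterᵇ-< p⊆q x∈ys ¬px qx)
  ... | true  | false | p⊆qᵧ with () ← p⊆qᵧ _
  ... | false | true  | _ = m≤n⇒m≤1+n (length-filterᵇ-< p⊆q x∈ys ¬px qx)
  ... | false | false | _ = length-filterᵇ-< p⊆q x∈ys ¬px qx

  length-filterᵇ-∨ : {p q : A → Bool} → (∀ x → ¬ (T (p x) × T (q x))) → ∀ xs →
    length (filterᵇ p xs) + length (filterᵇ q xs) ≡ length (filterᵇ (λ x → p x ∨ q x) xs)
  length-filterᵇ-∨ disj [] = refl
  length-filterᵇ-∨ {p} {q} disj (x ∷ xs) with p x | q x | disj x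
  ... | true  | true  | disjₓ with () ← disjₓ _
  ... | true  | false | _ = cong suc (length-filterᵇ-∨ disj xs)
  ... | false | true  | _ = trans (+-suc _ _) (cong suc (length-filterᵇ-∨ disj xs))
  ... | false | false | _ = length-filterᵇ-∨ disj xs

  length-filterᵇ-witness : ∀ {p : A → Bool} xs → 0 < length (filterᵇ p xs) → ∃ (T ∘ p)
  length-filterᵇ-witness {p} (x ∷ xs) pos with p x in px
  ... | true  = x , from T-≡ px
  ... | false = length-filterᵇ-witness xs pos

module _ {n : ℕ} where

  count≤n : (p : Fin n → Bool) → count p ≤ n
  count≤n p = ≤-trans (length-filter (T? ∘ p) (allFin n)) (≤-reflexive (length-tabulate id))

  count-pos : (p : Fin n → Bool) {x : Fin n} → T (p x) → 0 < count p
  count-pos p {x} px = filter-some (T? ∘ p) (lose (∈-allFin x) px)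

  count-mono : (p q : Fin n → Bool) → T ∘ p ⊆ᵖ T ∘ q → count p ≤ count q
  count-mono p q p⊆q = length-filterᵇ-mono p⊆q (allFin n)

  count-∨ : (p q : Fin n → Bool) → (∀ x → ¬ (T (p x) × T (q x))) →
    count p + count q ≡ count (λ x → p x ∨ q x)
  count-∨ p q disj = length-filterᵇ-∨ disj (allFin n)

  count-witness : (p : Fin n → Bool) → 0 < count p → ∃ (T ∘ p)
  count-witness p = length-filterᵇ-witness (allFin n)

  count-< : (p q : Fin n → Bool) → T ∘ p ⊆ᵖ T ∘ q →
    ∀ x → ¬ T (p x) → T (q x) → count p < count q
  count-< p q p⊆q x = length-filterᵇ-< p⊆q (∈-allFin x)

≤-2*-pos : ∀ {s c} → 0 < s → s ≤ 2 * c → 0 < c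
≤-2*-pos {c = zero}  s>0 s≤0 = ⊥-elim (<⇒≱ s>0 s≤0)
≤-2*-pos {c = suc c} _   _   = s≤s z≤n

three-halves-exceed : ∀ {s a b c} → 0 < s → s ≤ 2 * a → s ≤ 2 * b → s ≤ 2 * c → s < a + b + c
three-halves-exceed {s} {a} {b} {c} s>0 sa sb sc = ≰⇒> λ abc≤s → <⇒≱ s>0 (+-cancelˡ-≤ (s + s) s 0 (3s≤2s abc≤s))
  where
    open ≤-Reasoning
    3s≤2s : a + b + c ≤ s → s + s + s ≤ s + s + 0
    3s≤2s abc≤s = begin
      s + s + s             ≤⟨ +-mono-≤ (+-mono-≤ sa sb) sc ⟩
      2 * a + 2 * b + 2 * c ≡⟨ distrib a b c ⟩
      2 * (a + b + c)       ≤⟨ *-monoʳ-≤ 2 abc≤s ⟩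
      2 * s                 ≡⟨ double s ⟩
      s + s + 0             ∎
      where
        distrib : ∀ a b c → 2 * a + 2 * b + 2 * c ≡ 2 * (a + b + c)
        distrib = solve-∀
        double : ∀ s → 2 * s ≡ s + s + 0
        double = solve-∀

overlap-of-halves : {n : ℕ} (t p q r : Fin n → Bool) →
  T ∘ p ⊆ᵖ T ∘ t → T ∘ q ⊆ᵖ T ∘ t → T ∘ r ⊆ᵖ T ∘ t → 0 < count t →
  count t ≤ 2 * count p → count t ≤ 2 * count q → count t ≤ 2 * count r →
  ∃ λ x → T (p x) × T (q x) ⊎ T (p x) × T (r x) ⊎ T (q x) × T (r x)
overlap-of-halves t p q r p⊆t q⊆t r⊆t t>0 tp tq tr
  with any? (λ x → (T? (p x) ×-dec T? (q x)) ⊎-dec (T? (p x) ×-dec T? (r x)) ⊎-dec (T? (q x) ×-dec T? (r x)))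
... | yes common = common
... | no disjoint = ⊥-elim (<⇒≱ (three-halves-exceed {a = count p} {count q} {count r} t>0 tp tq tr) (begin
      count p + count q + count r       ≡⟨ cong (_+ count r) (count-∨ p q p∩q≡∅) ⟩
      count (λ x → p x ∨ q x) + count r ≡⟨ count-∨ (λ x → p x ∨ q x) r [p∪q]∩r≡∅ ⟩
      count (λ x → (p x ∨ q x) ∨ r x)   ≤⟨ count-mono _ t p∪q∪r⊆t ⟩
      count t                           ∎))
  where
    open ≤-Reasoning
    p∩q≡∅ : ∀ x → ¬ (T (p x) × T (q x))
    p∩q≡∅ x pq = disjoint (x , inj₁ pq)
    [p∪q]∩r≡∅ : ∀ x → ¬ (T (p x ∨ q x) × T (r x))
    [p∪q]∩r≡∅ x (p∪q , rx) =
      disjoint (x , inj₂ ([ (λ px → inj₁ (px , rx)) , (λ qx → inj₂ (qx , rx)) ] (to (T-∨ {p x} {q x}) p∪q)))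
    p∪q∪r⊆t : T ∘ (λ x → (p x ∨ q x) ∨ r x) ⊆ᵖ T ∘ t
    p∪q∪r⊆t {x} p∪q∪r = [ [ p⊆t , q⊆t ] ∘ to (T-∨ {p x}) , r⊆t ] (to (T-∨ {p x ∨ q x}) p∪q∪r)

adj-sym : ∀ {n} (G : SimpleGraph n) {u v} → adj G u v ≡ true → adj G v u ≡ true
adj-sym G {u} {v} e = trans (sym G v u) e

module _ {n : ℕ} {G : SimpleGraph n} where

  module _ {S : Pred (Fin n) 0ℓ} where

    snocʷ : ∀ {u w v} → Walk G S u w → adj G w v ≡ true → S v → Walk G S u v
    snocʷ stop         e sv = step e sv stop
    snocʷ (step a s r) e sv = step a s (snocʷ r e sv)

    infixr 5 _++ʷ_
    _++ʷ_ : ∀ {u w v} → Walk G S u w → Walk G S w v → Walk G S u v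
    stop       ++ʷ r′ = r′
    step a s r ++ʷ r′ = step a s (r ++ʷ r′)

    reverseʷ : ∀ {u v} → S u → Walk G S u v → Walk G S v u
    reverseʷ su stop          = stop
    reverseʷ su (step a sw r) = snocʷ (reverseʷ sw r) (adj-sym G a) su

    walk-target : ∀ {u v} → S u → Walk G S u v → S v
    walk-target su stop          = su
    walk-target su (step a sw r) = walk-target sw r

    via-common-neighbour : ∀ {x y s} → adj G x s ≡ true → adj G y s ≡ true → S s → S y →
      Walk G S x y
    via-common-neighbour xs ys ss sy = step xs ss (step (adj-sym G ys) sy stop)

  mapʷ : ∀ {S S′ : Pred (Fin n) 0ℓ} → S ⊆ᵖ S′ → ∀ {u v} → Walk G S u v → Walk G S′ u v
  mapʷ S⊆S′ stop         = stop
  mapʷ S⊆S′ (step a s r) = step a (S⊆S′ s) (mapʷ S⊆S′ r)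

module Reachability {n : ℕ} (G : SimpleGraph n) {S : Pred (Fin n) 0ℓ} (S? : Decidable S)
                    (u : Fin n) where

  Entered : (Fin n → Bool) → Pred (Fin n) 0ℓ
  Entered R v = S v × ∃ λ w → T (R w) × adj G w v ≡ true

  entered? : (R : Fin n → Bool) → Decidable (Entered R)
  entered? R v = S? v ×-dec any? (λ w → T? (R w) ×-dec adj G w v ≟ᵇ true)

  reach : ℕ → Fin n → Bool
  reach zero    v = ⌊ u ≟ v ⌋
  reach (suc m) v = reach m v ∨ ⌊ entered? (reach m) v ⌋

  reach-start : T (reach zero u)
  reach-start = fromWitness refl

  reach-keep : ∀ m v → T (reach m v) → T (reach (suc m) v)
  reach-keep m v = from (T-∨ {reach m v}) ∘ inj₁

  reach-enter : ∀ m v → Entered (reach m) v → T (reach (suc m) v)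
  reach-enter m v = from (T-∨ {reach m v}) ∘ inj₂ ∘ fromWitness

  reach-suc⁻ : ∀ m v → T (reach (suc m) v) → T (reach m v) ⊎ Entered (reach m) v
  reach-suc⁻ m v = Sum.map₂ toWitness ∘ to (T-∨ {reach m v})

  reach-sound : ∀ m v → T (reach m v) → Walk G S u v
  reach-sound zero    v r with refl ← toWitness r = stop
  reach-sound (suc m) v r with reach-suc⁻ m v r
  ... | inj₁ r′                 = reach-sound m v r′
  ... | inj₂ (sv , w , rw , e) = snocʷ (reach-sound m w rw) e sv

  reach-complete : ∀ m {w v} → T (reach m w) → Walk G S w v → ∃ λ m′ → T (reach m′ v)
  reach-complete m r stop                       = m , r
  reach-complete m r (step {w = w′} e sw′ rest) =
    reach-complete (suc m) (reach-enter m w′ (sw′ , _ , r , e)) rest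

  reach-mono : ∀ {m m′} v → m ≤′ m′ → T (reach m v) → T (reach m′ v)
  reach-mono v ≤′-refl           = id
  reach-mono v (≤′-step {m′} le) = reach-keep m′ v ∘ reach-mono v le

  Stable : ℕ → Set
  Stable m = ∀ v → T (reach (suc m) v) → T (reach m v)

  stable-suc : ∀ m → Stable m → Stable (suc m)
  stable-suc m st v r with reach-suc⁻ (suc m) v r
  ... | inj₁ r′                 = r′
  ... | inj₂ (sv , w , rw , e) = reach-enter m v (sv , w , st w rw , e)

  stable-mono : ∀ {m m′} → m ≤′ m′ → Stable m → Stable m′
  stable-mono ≤′-refl           = id
  stable-mono (≤′-step {m′} le) = stable-suc m′ ∘ stable-mono le

  stable-absorbs : ∀ {m m′} v → Stable m → m ≤′ m′ → T (reach m′ v) → T (reach m v)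
  stable-absorbs v st ≤′-refl      = id
  stable-absorbs v st (≤′-step le) = stable-absorbs v st le ∘ stable-mono le st v

  stable-or-grows : ∀ m → Stable m ⊎ count (reach m) < count (reach (suc m))
  stable-or-grows m with any? (λ v → T? (reach (suc m) v) ×-dec ¬? (T? (reach m v)))
  ... | yes (v , new , ¬old) = inj₂ (count-< (reach m) (reach (suc m)) (reach-keep m _) v ¬old new)
  ... | no ¬new = inj₁ λ v r → decidable-stable (T? (reach m v)) (λ ¬old → ¬new (v , r , ¬old))

  stable-or-large : ∀ j → ∃ Stable ⊎ suc j ≤ count (reach j)
  stable-or-large zero = inj₂ (count-pos (reach zero) reach-start)
  stable-or-large (suc j) with stable-or-large j | stable-or-grows j
  ... | inj₁ st    | _          = inj₁ st
  ... | inj₂ _     | inj₁ st    = inj₁ (j , st)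
  ... | inj₂ large | inj₂ grows = inj₂ (<-≤-trans (s≤s large) grows)

  -- reach 0 ⊆ reach 1 ⊆ … are subsets of Fin n, so they cannot grow n times.
  stable-stage : ∃ Stable
  stable-stage with stable-or-large n
  ... | inj₁ st    = st
  ... | inj₂ large = ⊥-elim (<⇒≱ large (count≤n (reach n)))

  walk? : ∀ v → Dec (Walk G S u v)
  walk? v with stable-stage
  ... | m₀ , st with T? (reach m₀ v)
  ... | yes r = yes (reach-sound m₀ v r)
  ... | no ¬r = no λ w → ¬r (saturate (reach-complete zero reach-start w))
    where
      saturate : (∃ λ m → T (reach m v)) → T (reach m₀ v)
      saturate (m , r) with ≤-total m m₀
      ... | inj₁ m≤m₀ = reach-mono v (≤⇒≤′ m≤m₀) r
      ... | inj₂ m₀≤m = stable-absorbs v st (≤⇒≤′ m₀≤m) r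

module _ {n : ℕ} (G : SimpleGraph n) {S : Pred (Fin n) 0ℓ} (S? : Decidable S) where

  open Reachability G S? using (walk?)

  connected? : Dec (Connected G S)
  connected? = all? λ u → all? λ v → S? u →-dec S? v →-dec walk? u v

  unreachable : ∀ {u} → ¬ Connected G S → S u → ∃ λ z → S z × ¬ Walk G S u z
  unreachable {u} ¬conn su with all? (λ z → S? z →-dec walk? u z)
  ... | yes reach-all = ⊥-elim (¬conn λ x y sx sy → reverseʷ su (reach-all x sx) ++ʷ reach-all y sy)
  ... | no ¬reach-all with ¬∀⟶∃¬ n _ (λ z → S? z →-dec walk? u z) ¬reach-all
  ... | z , ¬reach-z with S? z
  ...   | yes sz = z , sz , λ w → ¬reach-z λ _ → w
  ...   | no ¬sz = ⊥-elim (¬reach-z (⊥-elim ∘ ¬sz))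

∣p∪q∣≤∣p∣+∣q∣ : ∀ {k} (p q : Subset k) → ∣ p ∪ q ∣ ≤ ∣ p ∣ + ∣ q ∣
∣p∪q∣≤∣p∣+∣q∣ []          []          = z≤n
∣p∪q∣≤∣p∣+∣q∣ (true ∷ p)  (true ∷ q)  = s≤s (≤-trans (∣p∪q∣≤∣p∣+∣q∣ p q) (+-monoʳ-≤ ∣ p ∣ (n≤1+n ∣ q ∣)))
∣p∪q∣≤∣p∣+∣q∣ (true ∷ p)  (false ∷ q) = s≤s (∣p∪q∣≤∣p∣+∣q∣ p q)
∣p∪q∣≤∣p∣+∣q∣ (false ∷ p) (true ∷ q)  = ≤-trans (s≤s (∣p∪q∣≤∣p∣+∣q∣ p q)) (≤-reflexive (≡-sym (+-suc ∣ p ∣ ∣ q ∣)))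
∣p∪q∣≤∣p∣+∣q∣ (false ∷ p) (false ∷ q) = ∣p∪q∣≤∣p∣+∣q∣ p q

∣⁅x⁆∪⁅y⁆∣≤2 : ∀ {k} (x y : Fin k) → ∣ ⁅ x ⁆ ∪ ⁅ y ⁆ ∣ ≤ 2
∣⁅x⁆∪⁅y⁆∣≤2 x y = ≤-trans (∣p∪q∣≤∣p∣+∣q∣ ⁅ x ⁆ ⁅ y ⁆) (≤-reflexive (cong₂ _+_ (∣⁅x⁆∣≡1 x) (∣⁅x⁆∣≡1 y)))

∣q∣<∣p∣⇒∃p∖q : ∀ {k} {p q : Subset k} → ∣ q ∣ < ∣ p ∣ → ∃ λ x → x ∈ p × x ∉ q
∣q∣<∣p∣⇒∃p∖q {p = p} {q} ∣q∣<∣p∣ with any? (λ x → x ∈? p ×-dec ¬? (x ∈? q))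
... | yes p∖q = p∖q
... | no ¬p∖q = ⊥-elim (<⇒≱ ∣q∣<∣p∣ (p⊆q⇒∣p∣≤∣q∣ p⊆q))
  where
    p⊆q : p ⊆ q
    p⊆q {x} x∈p = decidable-stable (x ∈? q) (λ x∉q → ¬p∖q (x , x∈p , x∉q))

three-members : ∀ {k} {F : Subset k} → 3 ≤ ∣ F ∣ →
  ∃ λ a → ∃ λ b → ∃ λ c → a ∈ F × b ∈ F × c ∈ F × a ≢ b × a ≢ c × b ≢ c
three-members {k} {F} ∣F∣≥3
  with ∣q∣<∣p∣⇒∃p∖q {q = ⊥} (≤-<-trans (≤-reflexive (∣⊥∣≡0 k)) (≤-trans (s≤s z≤n) ∣F∣≥3))
... | a , a∈F , _
  with ∣q∣<∣p∣⇒∃p∖q {q = ⁅ a ⁆} (≤-<-trans (≤-reflexive (∣⁅x⁆∣≡1 a)) (≤-trans (s≤s (s≤s z≤n)) ∣F∣≥3))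
... | b , b∈F , b∉a
  with ∣q∣<∣p∣⇒∃p∖q {q = ⁅ a ⁆ ∪ ⁅ b ⁆} (≤-<-trans (∣⁅x⁆∪⁅y⁆∣≤2 a b) ∣F∣≥3)
... | c , c∈F , c∉ab =
  a , b , c , a∈F , b∈F , c∈F ,
  (λ a≡b → x∉⁅y⁆⇒x≢y b∉a (≡-sym a≡b)) ,
  (λ { refl → c∉ab (x∈p∪q⁺ (inj₁ (x∈⁅x⁆ a))) }) ,
  (λ { refl → c∉ab (x∈p∪q⁺ (inj₂ (x∈⁅x⁆ b))) })

Pair : ∀ {k} → Fin k → Fin k → Pred (Fin k) 0ℓ
Pair i j c = c ≡ i ⊎ c ≡ j

Triple : ∀ {k} → Fin k → Fin k → Fin k → Pred (Fin k) 0ℓ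
Triple i j l c = c ≡ i ⊎ Pair j l c

pair? : ∀ {k} (i j : Fin k) → Decidable (Pair i j)
pair? i j c = c ≟ i ⊎-dec c ≟ j

triple? : ∀ {k} (i j l : Fin k) → Decidable (Triple i j l)
triple? i j l c = c ≟ i ⊎-dec pair? j l c

pair⊆triple : ∀ {k} {i j l : Fin k} → Pair i j ⊆ᵖ Triple i j l
pair⊆triple = [ inj₁ , inj₂ ∘ inj₁ ]

module _ {n k : ℕ} (G : SimpleGraph n) (col : Fin n → Fin k) where

  triplet? : ∀ F → Dec (ContainsTriplet G col F)
  triplet? F = any? λ i → any? λ j → any? λ l →
    i ∈? F ×-dec j ∈? F ×-dec l ∈? F ×-dec
    ¬? (i ≟ j) ×-dec ¬? (i ≟ l) ×-dec ¬? (j ≟ l) ×-dec connected? G (triple? i j l ∘ col)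

  module _ (nonempty : NonemptyTerminals col) (dense : HalfDense G col) where

    adjIn : Fin n → Fin k → Fin n → Bool
    adjIn x i s = adj G x s ∧ inT col i s

    adjIn⁻ : ∀ {x i s} → T (adjIn x i s) → adj G x s ≡ true × col s ≡ i
    adjIn⁻ {x} {i} {s} = map (to T-≡) toWitness ∘ to (T-∧ {adj G x s})

    size-pos : ∀ i → 0 < size col i
    size-pos i = count-pos (inT col i) (fromWitness (proj₂ (nonempty i)))

    neighbour-in : ∀ {t j} → col t ≢ j → ∃ λ v → adj G t v ≡ true × col v ≡ j
    neighbour-in {t} {j} t∉j =
      map₂ adjIn⁻ (count-witness (adjIn t j) (≤-2*-pos (size-pos j) (dense t j t∉j)))

    step-out : ∀ {S : Pred (Fin n) 0ℓ} {i j y} → i ≢ j → col ⊢ (_≡ j) ⊆ᵖ S → S y →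
      ∃ λ a → col a ≢ i × Walk G S y a
    step-out {i = i} {j} {y} i≢j Tⱼ⊆S sy with col y ≟ i
    ... | no  y∉i = y , y∉i , stop
    ... | yes y∈i with neighbour-in (λ y∈j → i≢j (trans (≡-sym y∈i) y∈j))
    ... | a , ya , a∈j = a , (λ a∈i → i≢j (trans (≡-sym a∈i) a∈j)) , step ya (Tⱼ⊆S a∈j) stop

    CommonNeighbour : Fin n → Fin n → Fin n → Set
    CommonNeighbour x y s = adj G x s ≡ true × adj G y s ≡ true

    common-neighbour⁻ : ∀ {x y i s} → T (adjIn x i s) → T (adjIn y i s) →
      col s ≡ i × CommonNeighbour x y s
    common-neighbour⁻ xs ys = proj₂ (adjIn⁻ xs) , proj₁ (adjIn⁻ xs) , proj₁ (adjIn⁻ ys)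

    shared-neighbour : ∀ {i a b d} → col a ≢ i → col b ≢ i → col d ≢ i →
      ∃ λ s → col s ≡ i × (CommonNeighbour a b s ⊎ CommonNeighbour a d s ⊎ CommonNeighbour b d s)
    shared-neighbour {i} {a} {b} {d} a∉i b∉i d∉i
      with overlap-of-halves (inT col i) (adjIn a i) (adjIn b i) (adjIn d i)
             (proj₂ ∘ to T-∧) (proj₂ ∘ to T-∧) (proj₂ ∘ to T-∧)
             (size-pos i) (dense a i a∉i) (dense b i b∉i) (dense d i d∉i)
    ... | s , inj₁ (as , bs)        = s , map₂ inj₁ (common-neighbour⁻ as bs)
    ... | s , inj₂ (inj₁ (as , ds)) = s , map₂ (inj₂ ∘ inj₁) (common-neighbour⁻ as ds)
    ... | s , inj₂ (inj₂ (bs , ds)) = s , map₂ (inj₂ ∘ inj₂) (common-neighbour⁻ bs ds)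

    reroute : ∀ {i j l v w} → i ≢ j → ¬ Connected G (col ⊢ Triple i j l) →
      Pair i j (col v) → Pair i j (col w) →
      Walk G (col ⊢ Triple i j l) v w → Walk G (col ⊢ Pair i j) v w
    reroute {i} {j} {l} {v} {w} i≢j ¬conn v∈ij w∈ij vw
      with Reachability.walk? G (pair? i j ∘ col) v w
    ... | yes vw′ = vw′
    ... | no ¬vw′ with unreachable G (triple? i j l ∘ col) ¬conn (pair⊆triple v∈ij)
    ... | z , z∈ijl , ¬vz
      with step-out i≢j inj₂ v∈ij | step-out i≢j inj₂ w∈ij | step-out i≢j (inj₂ ∘ inj₁) z∈ijl
    ... | a , a∉i , va | b , b∉i , wb | d , d∉i , zd with shared-neighbour a∉i b∉i d∉i
    ... | s , s∈i , inj₁ (as , bs) = ⊥-elim (¬vw′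
          (va ++ʷ via-common-neighbour as bs (inj₁ s∈i) (walk-target w∈ij wb) ++ʷ reverseʷ w∈ij wb))
    ... | s , s∈i , inj₂ (inj₁ (as , ds)) = ⊥-elim (¬vz
          (mapʷ pair⊆triple va ++ʷ via-common-neighbour as ds (inj₁ s∈i) (walk-target z∈ijl zd) ++ʷ
           reverseʷ z∈ijl zd))
    ... | s , s∈i , inj₂ (inj₂ (bs , ds)) = ⊥-elim (¬vz
          (vw ++ʷ mapʷ pair⊆triple wb ++ʷ via-common-neighbour bs ds (inj₁ s∈i) (walk-target z∈ijl zd) ++ʷ
           reverseʷ z∈ijl zd))

    module _ (F : Subset k) (no-triplet : ¬ ContainsTriplet G col F) where

      pair⊆F : ∀ {i j} → i ∈ F → j ∈ F → Pair i j ⊆ᵖ (_∈ F)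
      pair⊆F i∈F j∈F (inj₁ refl) = i∈F
      pair⊆F i∈F j∈F (inj₂ refl) = j∈F

      disconnected : ∀ {i j l} → i ∈ F → j ∈ F → l ∈ F → i ≢ j → i ≢ l → j ≢ l →
        ¬ Connected G (col ⊢ Triple i j l)
      disconnected i∈F j∈F l∈F i≢j i≢l j≢l conn =
        no-triplet (_ , _ , _ , i∈F , j∈F , l∈F , i≢j , i≢l , j≢l , conn)

      Linked : Fin n → Fin n → Set
      Linked x s = ∀ {i j} → i ∈ F → j ∈ F → i ≢ j →
        Pair i j (col x) → Pair i j (col s) → Walk G (col ⊢ Pair i j) x s

      linked-refl : ∀ {x} → Linked x x
      linked-refl _ _ _ _ _ = stop

      linked-step : ∀ {x s s′} → col s ∈ F → Linked x s → adj G s s′ ≡ true → Linked x s′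
      linked-step {x} {s} {s′} s∈F x~s ss′ {i} {j} i∈F j∈F i≢j x∈ij s′∈ij with pair? i j (col s)
      ... | yes s∈ij = snocʷ (x~s i∈F j∈F i≢j x∈ij s∈ij) ss′ s′∈ij
      ... | no  s∉ij = reroute i≢j ¬conn x∈ij s′∈ij
            (snocʷ (mapʷ into (x~s x∈F s∈F x≢s (inj₁ refl) (inj₂ refl))) ss′ (pair⊆triple s′∈ij))
        where
          ¬conn : ¬ Connected G (col ⊢ Triple i j (col s))
          ¬conn = disconnected i∈F j∈F s∈F i≢j (s∉ij ∘ inj₁ ∘ ≡-sym) (s∉ij ∘ inj₂ ∘ ≡-sym)
          x∈F : col x ∈ F
          x∈F = pair⊆F i∈F j∈F x∈ij
          x≢s : col x ≢ col s
          x≢s x≡s = s∉ij (subst (Pair i j) x≡s x∈ij)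
          into : col ⊢ Pair (col x) (col s) ⊆ᵖ col ⊢ Triple i j (col s)
          into (inj₁ y≡x) = pair⊆triple (subst (Pair i j) (≡-sym y≡x) x∈ij)
          into (inj₂ y≡s) = inj₂ (inj₂ y≡s)

      linked-along : ∀ {x s y} → col s ∈ F → Linked x s → Walk G (UnionOf col F) s y → Linked x y
      linked-along s∈F x~s stop              = x~s
      linked-along s∈F x~s (step ss′ s′∈F r) = linked-along s′∈F (linked-step s∈F x~s ss′) r

      triplet-free-disconnected : 3 ≤ ∣ F ∣ → ¬ Connected G (UnionOf col F)
      triplet-free-disconnected ∣F∣≥3 conn with three-members ∣F∣≥3
      ... | a , b , c , a∈F , b∈F , c∈F , a≢b , a≢c , b≢c with nonempty a
      ... | x , x∈a
        with unreachable G (triple? a b c ∘ col) (disconnected a∈F b∈F c∈F a≢b a≢c b≢c) (inj₁ x∈a)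
      ... | y , y∈abc , ¬xy = ¬xy (walk y∈abc)
        where
          x∈F : col x ∈ F
          x∈F = pair⊆F a∈F b∈F (inj₁ x∈a)
          y∈F : col y ∈ F
          y∈F = [ pair⊆F a∈F b∈F ∘ inj₁ , pair⊆F b∈F c∈F ] y∈abc
          x~y : Linked x y
          x~y = linked-along x∈F linked-refl (conn x y x∈F y∈F)
          walk : Triple a b c (col y) → Walk G (col ⊢ Triple a b c) x y
          walk (inj₁ y∈a)        = mapʷ pair⊆triple (x~y a∈F b∈F a≢b (inj₁ x∈a) (inj₁ y∈a))
          walk (inj₂ (inj₁ y∈b)) = mapʷ pair⊆triple (x~y a∈F b∈F a≢b (inj₁ x∈a) (inj₂ y∈b))
          walk (inj₂ (inj₂ y∈c)) = mapʷ [ inj₁ , inj₂ ∘ inj₂ ] (x~y a∈F c∈F a≢c (inj₁ x∈a) (inj₂ y∈c))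

lemma2 : (n k : ℕ) (G : SimpleGraph n) (col : Fin n → Fin k) →
         NonemptyTerminals col → HalfDense G col →
         (F : Subset k) → Connected G (UnionOf col F) → 4 ≤ ∣ F ∣ →
         ContainsTriplet G col F
lemma2 n k G col nonempty dense F conn ∣F∣≥4 with triplet? G col F
... | yes triplet   = triplet
... | no no-triplet =
  ⊥-elim (triplet-free-disconnected G col nonempty dense F no-triplet (≤-trans (n≤1+n 3) ∣F∣≥4) conn)
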